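{- The misère suspense number $S^-$ of paths is non-decreasing in $n$, and for every $n\ge 0$: 1. $S^-(P_{7\cdot 2^n-6})=2n+1$; 2. $S^-(P_{7\cdot 2^n-5})=2n+1$; 3. $S^-(P_k)=2n+2$ for every $k$ with $7\cdot 2^n-4\le k\le 7\cdot 2^{n+1}-7$.
   Context: For $n\ge 0$, $P_n$ denotes the path on $n$ vertices ($P_0$ is the empty graph). A Node-Kayles move on a path $P_k$ with $k\ge 1$ chooses a vertex and deletes it together with its neighbours. The possible results are: $P_0$ if $k\in\{1,2\}$; $P_0$ or $P_1$ if $k=3$; and, for $k\ge 4$, $P_{k-2}$, $P_{k-3}$, or two paths $P_i,P_j$ with $j\ge i\ge1$, $i+j=k-3$. In the continued conjunctive compound game, a position $G$ is a finite multiset of paths (components). A move replaces every nonempty component simultaneously by the result of a Node-Kayles move on it; a split component yields two components. The set $O(G)$ of options of $G$ consists of all positions obtainable by one such move, and $O(G)=\emptyset$ exactly when all components are empty. The misère suspense number $S^-$ is defined recursively as follows: - $S^-(G)=0$ if $O(G)=\emptyset$; - $S^-(G)=1+\max\{S^-(G'):G'\in O(G),\ S^-(G')\text{ odd}\}$ if some option has odd suspense number; - $S^-(G)=1+\min\{S^-(G'):G'\in O(G)\}$ otherwise, in which case all these values are even. $S^-(P_n)$ denotes the suspense number of the single component $P_n$. -}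

module Defs where

open import Data.Nat using (ℕ; zero; suc; _+_; _∸_; _⊔_; _⊓_; _%_)
open import Data.Bool using (Bool; true; false; _∧_; if_then_else_)
open import Data.List using (List; []; _∷_; _++_; map; concatMap)
open import Data.Nat.ListAction using (sum)

-- A position: a finite multiset of paths, represented as a list of path
-- lengths (the order of the list is irrelevant; 0 stands for P_0).
Position : Set
Position = List ℕ

-- Pairs (i , k ∸ 3 ∸ i) for i = 1 .. ⌊(k-3)/2⌋ : splits of P_k into P_i , P_j, j ≥ i ≥ 1.
-- splitsFrom i r : all [i' , r ∸ i'] with i ≤ i' ≤ r ∸ i', enumerated by fuel.
splitsAux : ℕ → ℕ → ℕ → List (List ℕ)
splitsAux zero    i r = []
splitsAux (suc f) i r with (i + i) Data.Nat.≤ᵇ r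
... | true  = (i ∷ (r ∸ i) ∷ []) ∷ splitsAux f (suc i) r
... | false = []

splits : ℕ → List (List ℕ)
splits r = splitsAux r 1 r

-- Results of a Node-Kayles move on the component P_k (each result is the
-- list of components it becomes).  An empty component P_0 stays empty.
moves : ℕ → List (List ℕ)
moves 0 = (0 ∷ []) ∷ []
moves 1 = (0 ∷ []) ∷ []
moves 2 = (0 ∷ []) ∷ []
moves 3 = (0 ∷ []) ∷ (1 ∷ []) ∷ []
moves (suc (suc (suc (suc m)))) =
  ((2 + m) ∷ []) ∷ ((1 + m) ∷ []) ∷ splits (1 + m)

allMoves : Position → List Position
allMoves []      = [] ∷ []
allMoves (k ∷ G) = concatMap (λ r → map (r ++_) (allMoves G)) (moves k)

isZero : ℕ → Bool
isZero zero    = true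
isZero (suc _) = false

allEmpty : Position → Bool
allEmpty []      = true
allEmpty (k ∷ G) = isZero k ∧ allEmpty G

options : Position → List Position
options G = if allEmpty G then [] else allMoves G

isOdd : ℕ → Bool
isOdd n = isZero (n % 2) Data.Bool.xor true

oddsOf : List ℕ → List ℕ
oddsOf []      = []
oddsOf (x ∷ xs) = if isOdd x then x ∷ oddsOf xs else oddsOf xs

maxL : List ℕ → ℕ
maxL []       = 0
maxL (x ∷ xs) = x ⊔ maxL xs

minL : List ℕ → ℕ
minL []       = 0
minL (x ∷ []) = x
minL (x ∷ xs@(_ ∷ _)) = x ⊓ minL xs

-- Every move from a position
-- with some nonempty component strictly decreases the total number of
-- vertices, so fuel (total + 1) is enough for the recursion never to run out.
suspenseF : ℕ → Position → ℕ
suspenseF zero    G = 0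
suspenseF (suc f) G with options G
... | []        = 0
... | os@(_ ∷ _) with oddsOf (map (suspenseF f) os)
...   | []          = suc (minL (map (suspenseF f) os))
...   | odds@(_ ∷ _) = suc (maxL odds)

suspense : Position → ℕ
suspense G = suspenseF (suc (sum G)) G

Sp : ℕ → ℕ
Sp n = suspense (n ∷ [])

-- The misère suspense rule picks, among the values of the options, the greatest one for the
-- order ≼ in which odd values beat even ones, larger odd values beat smaller ones and smaller
-- even values beat larger ones.  Taking a maximum with a fixed number is monotone for ≼, so the
-- value of a conjunctive compound is the maximum of the values of its components.  Hence
-- S⁻(P_k) is one more than the ≼-greatest value of the positions left by the moves on P_k, and
-- once S⁻ is known to be monotone on shorter paths such a position is worth S⁻ of its largest
-- component.  By strong induction on k: on the even block [7·2ⁿ−4, 7·2ⁿ⁺¹−7] some move leaves a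
-- largest component in the odd block [7·2ⁿ−6, 7·2ⁿ−5], worth 2n+1, and no component is worth
-- more than 2n+2, so S⁻ = 2n+2; on the odd block every move leaves a largest component in the
-- even block of level n−1, worth 2n, so S⁻ = 2n+1.  Monotonicity follows from these values.

module Submission where

open import Defs
open import Data.Nat using (ℕ; zero; suc; _+_; _*_; _∸_; _^_; _%_; _≤_; _<_; _⊔_; z≤n; s≤s; _≤ᵇ_; _≟_; _≤?_; _<?_)
open import Data.Nat.Properties
open import Data.Nat.DivMod using ([m+n]%n≡m%n)
open import Data.Nat.Induction using (<-rec)
open import Data.Nat.ListAction using (sum)
open import Data.Nat.ListAction.Properties using (sum-++)
open import Data.Nat.Tactic.RingSolver using (solve-∀)
open import Data.Bool using (true; false; T; if_then_else_; _xor_)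
open import Data.List using (List; []; _∷_; _++_; map)
open import Data.List.Properties using (map-cong-local; ++-identityʳ)
import Data.List.Relation.Unary.All as All
open import Data.List.Relation.Unary.Any using (here; there)
open import Data.List.Membership.Propositional using (_∈_)
open import Data.List.Membership.Propositional.Properties using (∈-map⁺; ∈-map⁻; ∈-concat⁻′; ∈-concat⁺′)
open import Data.Product using (_×_; _,_; ∃; ∃₂; proj₁; proj₂; map₁)
open import Data.Sum using (_⊎_; inj₁; inj₂; [_,_]′) renaming (map to ⊎-map)
open import Data.Empty using (⊥; ⊥-elim)
open import Function using (_∘_; id)
open import Relation.Nullary using (yes; no)
open import Relation.Unary using (_≐_)
open import Relation.Unary.Properties using (≐-trans; ≐-sym)
open import Relation.Binary.PropositionalEquality

data Odd (n : ℕ) : Set where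
  odd : isOdd n ≡ true → Odd n

data Even (n : ℕ) : Set where
  even : isOdd n ≡ false → Even n

parity : ∀ n → Odd n ⊎ Even n
parity n with isOdd n in eq
... | true  = inj₁ (odd eq)
... | false = inj₂ (even eq)

odd⇒¬even : ∀ {n} → Odd n → Even n → ⊥
odd⇒¬even (odd o) (even e) with trans (sym o) e
... | ()

2*[1+n]+c : ∀ n c → 2 * suc n + c ≡ 2 + (2 * n + c)
2*[1+n]+c = solve-∀

2*[1+n] : ∀ n → 2 * suc n ≡ suc (2 * n + 1)
2*[1+n] = solve-∀

2*[1+n]+1 : ∀ n → 2 * suc n + 1 ≡ suc (2 * n + 2)
2*[1+n]+1 = solve-∀

isOdd-2+ : ∀ n → isOdd (2 + n) ≡ isOdd n
isOdd-2+ n = cong (λ r → isZero r xor true) (trans (cong (_% 2) (+-comm 2 n)) ([m+n]%n≡m%n n 2))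

odd-2*n+1 : ∀ n → Odd (2 * n + 1)
odd-2*n+1 zero = odd refl
odd-2*n+1 (suc n) with odd-2*n+1 n
... | odd o = odd (trans (cong isOdd (2*[1+n]+c n 1)) (trans (isOdd-2+ (2 * n + 1)) o))

even-2*n+2 : ∀ n → Even (2 * n + 2)
even-2*n+2 zero = even refl
even-2*n+2 (suc n) with even-2*n+2 n
... | even e = even (trans (cong isOdd (2*[1+n]+c n 2)) (trans (isOdd-2+ (2 * n + 2)) e))

infix 4 _≼_
data _≼_ : ℕ → ℕ → Set where
  even≼odd  : ∀ {x y} → Even x → Odd y → x ≼ y
  odd≼odd   : ∀ {x y} → Odd x → Odd y → x ≤ y → x ≼ y
  even≼even : ∀ {x y} → Even x → Even y → y ≤ x → x ≼ y

≼-refl : ∀ x → x ≼ x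
≼-refl x with parity x
... | inj₁ o = odd≼odd o o ≤-refl
... | inj₂ e = even≼even e e ≤-refl

≼-reflexive : ∀ {x y} → x ≡ y → x ≼ y
≼-reflexive {x} refl = ≼-refl x

≼-trans : ∀ {x y z} → x ≼ y → y ≼ z → x ≼ z
≼-trans (even≼odd ex _)       (odd≼odd _ oz _)       = even≼odd ex oz
≼-trans (even≼odd _ oy)       (even≼odd ey _)        = ⊥-elim (odd⇒¬even oy ey)
≼-trans (even≼odd _ oy)       (even≼even ey _ _)     = ⊥-elim (odd⇒¬even oy ey)
≼-trans (odd≼odd ox _ x≤y)    (odd≼odd _ oz y≤z)     = odd≼odd ox oz (≤-trans x≤y y≤z)
≼-trans (odd≼odd _ oy _)      (even≼odd ey _)        = ⊥-elim (odd⇒¬even oy ey)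
≼-trans (odd≼odd _ oy _)      (even≼even ey _ _)     = ⊥-elim (odd⇒¬even oy ey)
≼-trans (even≼even ex _ _)    (even≼odd _ oz)        = even≼odd ex oz
≼-trans (even≼even ex _ y≤x)  (even≼even _ ez z≤y)   = even≼even ex ez (≤-trans z≤y y≤x)
≼-trans (even≼even _ ey _)    (odd≼odd oy _ _)       = ⊥-elim (odd⇒¬even oy ey)

≼-antisym : ∀ {x y} → x ≼ y → y ≼ x → x ≡ y
≼-antisym (odd≼odd _ _ x≤y)    (odd≼odd _ _ y≤x)    = ≤-antisym x≤y y≤x
≼-antisym (even≼even _ _ y≤x)  (even≼even _ _ x≤y)  = ≤-antisym x≤y y≤x
≼-antisym (even≼odd ex _)      (even≼odd _ ox)      = ⊥-elim (odd⇒¬even ox ex)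
≼-antisym (even≼odd ex _)      (odd≼odd _ ox _)     = ⊥-elim (odd⇒¬even ox ex)
≼-antisym (even≼odd _ oy)      (even≼even ey _ _)   = ⊥-elim (odd⇒¬even oy ey)
≼-antisym (odd≼odd _ oy _)     (even≼odd ey _)      = ⊥-elim (odd⇒¬even oy ey)
≼-antisym (odd≼odd _ oy _)     (even≼even ey _ _)   = ⊥-elim (odd⇒¬even oy ey)
≼-antisym (even≼even ex _ _)   (even≼odd _ ox)      = ⊥-elim (odd⇒¬even ox ex)
≼-antisym (even≼even _ ey _)   (odd≼odd oy _ _)     = ⊥-elim (odd⇒¬even oy ey)

≼-total : ∀ x y → x ≼ y ⊎ y ≼ x
≼-total x y with parity x | parity y
... | inj₁ ox | inj₂ ey = inj₂ (even≼odd ey ox)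
... | inj₂ ex | inj₁ oy = inj₁ (even≼odd ex oy)
... | inj₁ ox | inj₁ oy = ⊎-map (odd≼odd ox oy) (odd≼odd oy ox) (≤-total x y)
... | inj₂ ex | inj₂ ey = ⊎-map (even≼even ex ey) (even≼even ey ex) (≤-total y x)

≼-between-upper : ∀ {x y c} → x ≤ c → c ≤ y → x ≼ y → c ≼ y
≼-between-upper {c = c} _ c≤y (even≼odd _ oy) with parity c
... | inj₁ oc = odd≼odd oc oy c≤y
... | inj₂ ec = even≼odd ec oy
≼-between-upper {c = c} _ c≤y (odd≼odd _ oy _) with parity c
... | inj₁ oc = odd≼odd oc oy c≤y
... | inj₂ ec = even≼odd ec oy
≼-between-upper x≤c c≤y (even≼even _ _ y≤x) =
  ≼-reflexive (≤-antisym c≤y (≤-trans y≤x x≤c))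

≼-between-lower : ∀ {x y c} → y ≤ c → c ≤ x → x ≼ y → x ≼ c
≼-between-lower {c = c} _ c≤x (even≼odd ex _) with parity c
... | inj₁ oc = even≼odd ex oc
... | inj₂ ec = even≼even ex ec c≤x
≼-between-lower {c = c} _ c≤x (even≼even ex _ _) with parity c
... | inj₁ oc = even≼odd ex oc
... | inj₂ ec = even≼even ex ec c≤x
≼-between-lower y≤c c≤x (odd≼odd _ _ x≤y) =
  ≼-reflexive (≤-antisym (≤-trans x≤y y≤c) c≤x)

-- This is why the value of a conjunctive compound is the maximum over its components.
⊔-monoˡ-≼ : ∀ {x y} c → x ≼ y → x ⊔ c ≼ y ⊔ c
⊔-monoˡ-≼ {x} {y} c x≼y with ≤-total x c | ≤-total y c
... | inj₁ x≤c | inj₁ y≤c = subst₂ _≼_ (sym (m≤n⇒m⊔n≡n x≤c)) (sym (m≤n⇒m⊔n≡n y≤c)) (≼-refl c)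
... | inj₁ x≤c | inj₂ c≤y = subst₂ _≼_ (sym (m≤n⇒m⊔n≡n x≤c)) (sym (m≥n⇒m⊔n≡m c≤y)) (≼-between-upper x≤c c≤y x≼y)
... | inj₂ c≤x | inj₁ y≤c = subst₂ _≼_ (sym (m≥n⇒m⊔n≡m c≤x)) (sym (m≤n⇒m⊔n≡n y≤c)) (≼-between-lower y≤c c≤x x≼y)
... | inj₂ c≤x | inj₂ c≤y = subst₂ _≼_ (sym (m≥n⇒m⊔n≡m c≤x)) (sym (m≥n⇒m⊔n≡m c≤y)) x≼y

⊔-mono-≼ : ∀ {a a′ b b′} → a′ ≼ a → b′ ≼ b → a′ ⊔ b′ ≼ a ⊔ b
⊔-mono-≼ {a} {a′} {b} {b′} a′≼a b′≼b =
  ≼-trans (⊔-monoˡ-≼ b′ a′≼a) (subst₂ _≼_ (⊔-comm b′ a) (⊔-comm b a) (⊔-monoˡ-≼ a b′≼b))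

Chosen : (ℕ → Set) → ℕ → Set
Chosen P m = P m × (∀ {y} → P y → y ≼ m)

Chosen-unique : ∀ {P m m′} → Chosen P m → Chosen P m′ → m ≡ m′
Chosen-unique (m∈P , ub) (m′∈P , ub′) = ≼-antisym (ub′ m∈P) (ub m′∈P)

Chosen-resp : ∀ {P Q m} → P ≐ Q → Chosen P m → Chosen Q m
Chosen-resp (P⊆Q , Q⊆P) (m∈P , ub) = P⊆Q m∈P , λ y∈Q → ub (Q⊆P y∈Q)

Chosen-const : ∀ {P v} → P v → (∀ {y} → P y → y ≡ v) → Chosen P v
Chosen-const v∈P all-v = v∈P , λ y∈P → ≼-reflexive (all-v y∈P)

chosen-exists : ∀ {x} xs → x ∈ xs → ∃ (Chosen (_∈ xs))
chosen-exists (y ∷ []) _ = y , here refl , λ { (here refl) → ≼-refl y }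
chosen-exists (y ∷ ys@(_ ∷ _)) _ with chosen-exists ys (here refl)
... | m , m∈ys , ub with ≼-total y m
...   | inj₁ y≼m = m , there m∈ys , λ { (here refl) → y≼m ; (there p) → ub p }
...   | inj₂ m≼y = y , here refl , λ { (here refl) → ≼-refl y ; (there p) → ≼-trans (ub p) m≼y }

_⊔ᵖ_ : (ℕ → Set) → (ℕ → Set) → ℕ → Set
(A ⊔ᵖ B) x = ∃₂ λ a b → A a × B b × x ≡ a ⊔ b

Chosen-⊔ᵖ : ∀ {A B a b} → Chosen A a → Chosen B b → Chosen (A ⊔ᵖ B) (a ⊔ b)
Chosen-⊔ᵖ {a = a} {b} (a∈A , ubA) (b∈B , ubB) =
  (a , b , a∈A , b∈B , refl) , λ { (_ , _ , a′∈A , b′∈B , refl) → ⊔-mono-≼ (ubA a′∈A) (ubB b′∈B) }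

chooseValue : (odds values : List ℕ) → ℕ
chooseValue []           values = minL values
chooseValue odds@(_ ∷ _) values = maxL odds

suspenseRule : List ℕ → ℕ
suspenseRule []           = 0
suspenseRule xs@(_ ∷ _) = suc (chooseValue (oddsOf xs) xs)

suspenseF-unfold : ∀ f G → suspenseF (suc f) G ≡ suspenseRule (map (suspenseF f) (options G))
suspenseF-unfold f G with options G
... | [] = refl
... | os@(_ ∷ _) with oddsOf (map (suspenseF f) os)
...   | [] = refl
...   | _ ∷ _ = refl

∈-oddsOf⁻ : ∀ xs {y} → y ∈ oddsOf xs → y ∈ xs × Odd y
∈-oddsOf⁻ (x ∷ xs) p with isOdd x in eq | p
... | true  | here refl = here refl , odd eq
... | true  | there q   = map₁ there (∈-oddsOf⁻ xs q)
... | false | q         = map₁ there (∈-oddsOf⁻ xs q)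

∈-oddsOf⁺ : ∀ xs {y} → y ∈ xs → Odd y → y ∈ oddsOf xs
∈-oddsOf⁺ (x ∷ xs) (here refl) (odd o) rewrite o = here refl
∈-oddsOf⁺ (x ∷ xs) (there p)   oy with isOdd x
... | true  = there (∈-oddsOf⁺ xs p oy)
... | false = ∈-oddsOf⁺ xs p oy

maxL-upper : ∀ xs {y} → y ∈ xs → y ≤ maxL xs
maxL-upper (x ∷ xs) (here refl) = m≤m⊔n x (maxL xs)
maxL-upper (x ∷ xs) (there p)   = ≤-trans (maxL-upper xs p) (m≤n⊔m x (maxL xs))

maxL-∈ : ∀ x xs → maxL (x ∷ xs) ∈ x ∷ xs
maxL-∈ x []       = here (⊔-identityʳ x)
maxL-∈ x (y ∷ ys) with ⊔-sel x (maxL (y ∷ ys))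
... | inj₁ eq = here eq
... | inj₂ eq = there (subst (_∈ y ∷ ys) (sym eq) (maxL-∈ y ys))

minL-lower : ∀ xs {y} → y ∈ xs → minL xs ≤ y
minL-lower (x ∷ [])     (here refl) = ≤-refl
minL-lower (x ∷ y ∷ ys) (here refl) = m⊓n≤m x _
minL-lower (x ∷ y ∷ ys) (there p)   = ≤-trans (m⊓n≤n x _) (minL-lower (y ∷ ys) p)

minL-∈ : ∀ x xs → minL (x ∷ xs) ∈ x ∷ xs
minL-∈ x []       = here refl
minL-∈ x (y ∷ ys) with ⊓-sel x (minL (y ∷ ys))
... | inj₁ eq = here eq
... | inj₂ eq = there (subst (_∈ y ∷ ys) (sym eq) (minL-∈ y ys))

chooseValue-chosen : ∀ x xs → Chosen (_∈ x ∷ xs) (chooseValue (oddsOf (x ∷ xs)) (x ∷ xs))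
chooseValue-chosen x xs with oddsOf (x ∷ xs) in eq
... | [] = min∈ , λ y∈ → even≼even (all-even y∈) (all-even min∈) (minL-lower (x ∷ xs) y∈)
  where
  all-even : ∀ {y} → y ∈ x ∷ xs → Even y
  all-even {y} y∈ with parity y
  ... | inj₂ ey = ey
  ... | inj₁ oy with subst (y ∈_) eq (∈-oddsOf⁺ (x ∷ xs) y∈ oy)
  ...   | ()
  min∈ : minL (x ∷ xs) ∈ x ∷ xs
  min∈ = minL-∈ x xs
... | o ∷ os = proj₁ max-odd , bound
  where
  max-odd : maxL (o ∷ os) ∈ x ∷ xs × Odd (maxL (o ∷ os))
  max-odd = ∈-oddsOf⁻ (x ∷ xs) (subst (maxL (o ∷ os) ∈_) (sym eq) (maxL-∈ o os))
  bound : ∀ {y} → y ∈ x ∷ xs → y ≼ maxL (o ∷ os)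
  bound {y} y∈ with parity y
  ... | inj₁ oy = odd≼odd oy (proj₂ max-odd) (maxL-upper (o ∷ os) (subst (y ∈_) eq (∈-oddsOf⁺ (x ∷ xs) y∈ oy)))
  ... | inj₂ ey = even≼odd ey (proj₂ max-odd)

suspenseRule-chosen : ∀ {xs m} → Chosen (_∈ xs) m → suspenseRule xs ≡ suc m
suspenseRule-chosen {x ∷ xs} chosen = cong suc (Chosen-unique (chooseValue-chosen x xs) chosen)

componentMax : Position → ℕ
componentMax G = maxL (map Sp G)

componentMax-++ : ∀ G H → componentMax (G ++ H) ≡ componentMax G ⊔ componentMax H
componentMax-++ []      H = refl
componentMax-++ (k ∷ G) H =
  trans (cong (Sp k ⊔_) (componentMax-++ G H)) (sym (⊔-assoc (Sp k) (componentMax G) (componentMax H)))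

OptionMax : Position → ℕ → Set
OptionMax G x = ∃ λ O → O ∈ allMoves G × x ≡ componentMax O

MoveMax : ℕ → ℕ → Set
MoveMax k x = ∃ λ r → r ∈ moves k × x ≡ componentMax r

∈-allMoves⁻ : ∀ k G {O} → O ∈ allMoves (k ∷ G) → ∃₂ λ r t → r ∈ moves k × t ∈ allMoves G × O ≡ r ++ t
∈-allMoves⁻ k G O∈ with ∈-concat⁻′ (map (λ r → map (r ++_) (allMoves G)) (moves k)) O∈
... | _ , O∈rs , rs∈ with ∈-map⁻ (λ r → map (r ++_) (allMoves G)) rs∈
...   | r , r∈ , refl with ∈-map⁻ (r ++_) O∈rs
...     | t , t∈ , refl = r , t , r∈ , t∈ , refl

∈-allMoves⁺ : ∀ k G {r t} → r ∈ moves k → t ∈ allMoves G → r ++ t ∈ allMoves (k ∷ G)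
∈-allMoves⁺ k G {r} r∈ t∈ =
  ∈-concat⁺′ (∈-map⁺ (r ++_) t∈) (∈-map⁺ (λ r → map (r ++_) (allMoves G)) r∈)

OptionMax-∷ : ∀ k G → OptionMax (k ∷ G) ≐ MoveMax k ⊔ᵖ OptionMax G
OptionMax-∷ k G = to , from
  where
  to : ∀ {x} → OptionMax (k ∷ G) x → (MoveMax k ⊔ᵖ OptionMax G) x
  to (O , O∈ , refl) with ∈-allMoves⁻ k G O∈
  ... | r , t , r∈ , t∈ , refl =
    componentMax r , componentMax t , (r , r∈ , refl) , (t , t∈ , refl) , componentMax-++ r t
  from : ∀ {x} → (MoveMax k ⊔ᵖ OptionMax G) x → OptionMax (k ∷ G) x
  from (_ , _ , (r , r∈ , refl) , (t , t∈ , refl) , refl) =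
    r ++ t , ∈-allMoves⁺ k G r∈ t∈ , sym (componentMax-++ r t)

splitsAux-sound : ∀ f i R {r} → r ∈ splitsAux f i R → ∃ λ j → i ≤ j × j + j ≤ R × r ≡ j ∷ (R ∸ j) ∷ []
splitsAux-sound (suc f) i R r∈ with (i + i) ≤ᵇ R in eq | r∈
... | true | here refl = i , ≤-refl , ≤ᵇ⇒≤ (i + i) R (subst T (sym eq) _) , refl
... | true | there r∈′ with splitsAux-sound f (suc i) R r∈′
...   | j , i<j , j+j≤R , r≡ = j , <⇒≤ i<j , j+j≤R , r≡

splitsAux-complete : ∀ f i R j → i ≤ j → j + j ≤ R → j < i + f → j ∷ (R ∸ j) ∷ [] ∈ splitsAux f i R
splitsAux-complete zero i R j i≤j _ j<i+0 = ⊥-elim (<⇒≱ (subst (j <_) (+-identityʳ i) j<i+0) i≤j)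
splitsAux-complete (suc f) i R j i≤j j+j≤R j<i+f+1 with (i + i) ≤ᵇ R in eq
... | false = ⊥-elim (subst T eq (≤⇒≤ᵇ (≤-trans (+-mono-≤ i≤j i≤j) j+j≤R)))
... | true with i ≟ j
...   | yes refl = here refl
...   | no i≢j = there (splitsAux-complete f (suc i) R j (≤∧≢⇒< i≤j i≢j) j+j≤R (subst (j <_) (+-suc i f) j<i+f+1))

∈-splits⁻ : ∀ {R r} → r ∈ splits R → ∃₂ λ i j → 1 ≤ i × i ≤ j × i + j ≡ R × r ≡ i ∷ j ∷ []
∈-splits⁻ {R} r∈ with splitsAux-sound R 1 R r∈
... | i , 1≤i , i+i≤R , refl =
  i , R ∸ i , 1≤i , +-cancelˡ-≤ i i (R ∸ i) (subst (i + i ≤_) (sym i+[R∸i]≡R) i+i≤R) , i+[R∸i]≡R , refl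
  where
  i+[R∸i]≡R : i + (R ∸ i) ≡ R
  i+[R∸i]≡R = m+[n∸m]≡n (m+n≤o⇒m≤o i i+i≤R)

∈-splits⁺ : ∀ {R i j} → 1 ≤ i → i ≤ j → i + j ≡ R → i ∷ j ∷ [] ∈ splits R
∈-splits⁺ {R} {i} {j} 1≤i i≤j refl =
  subst (λ j′ → i ∷ j′ ∷ [] ∈ splits (i + j)) (m+n∸m≡n i j)
    (splitsAux-complete (i + j) 1 (i + j) i 1≤i (+-monoʳ-≤ i i≤j) (s≤s (m≤m+n i j)))

moves-shrink : ∀ k {r} → r ∈ moves (suc k) → sum r ≤ k
moves-shrink 0 (here refl) = z≤n
moves-shrink 1 (here refl) = z≤n
moves-shrink 2 (here refl) = z≤n
moves-shrink 2 (there (here refl)) = s≤s z≤n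
moves-shrink (suc (suc (suc m))) (here refl) = ≤-trans (≤-reflexive (+-identityʳ (2 + m))) (n≤1+n _)
moves-shrink (suc (suc (suc m))) (there (here refl)) = ≤-trans (≤-reflexive (+-identityʳ (1 + m))) (m≤n+m _ 2)
moves-shrink (suc (suc (suc m))) (there (there r∈)) with ∈-splits⁻ r∈
... | i , j , _ , _ , i+j≡1+m , refl =
  ≤-trans (≤-reflexive (trans (cong (i +_) (+-identityʳ j)) i+j≡1+m)) (m≤n+m _ 2)

moves-sum≤ : ∀ k {r} → r ∈ moves k → sum r ≤ k
moves-sum≤ zero    (here refl) = z≤n
moves-sum≤ (suc k) r∈ = ≤-trans (moves-shrink k r∈) (n≤1+n k)

allMoves-sum≤ : ∀ G {O} → O ∈ allMoves G → sum O ≤ sum G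
allMoves-sum≤ []      (here refl) = z≤n
allMoves-sum≤ (k ∷ G) O∈ with ∈-allMoves⁻ k G O∈
... | r , t , r∈ , t∈ , refl = ≤-trans (≤-reflexive (sum-++ r t)) (+-mono-≤ (moves-sum≤ k r∈) (allMoves-sum≤ G t∈))

allMoves-shrink : ∀ G {O} → allEmpty G ≡ false → O ∈ allMoves G → sum O < sum G
allMoves-shrink (zero ∷ G) ne O∈ with ∈-allMoves⁻ zero G O∈
... | _ , t , here refl , t∈ , refl = allMoves-shrink G ne t∈
allMoves-shrink (suc k ∷ G) _ O∈ with ∈-allMoves⁻ (suc k) G O∈
... | r , t , r∈ , t∈ , refl =
  ≤-trans (s≤s (≤-reflexive (sum-++ r t))) (+-mono-≤ (s≤s (moves-shrink k r∈)) (allMoves-sum≤ G t∈))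

OptionMax-0∷ : ∀ G → OptionMax (0 ∷ G) ≐ OptionMax G
OptionMax-0∷ G = to , from
  where
  to : ∀ {x} → OptionMax (0 ∷ G) x → OptionMax G x
  to (O , O∈ , refl) with ∈-allMoves⁻ 0 G O∈
  ... | _ , t , here refl , t∈ , refl = t , t∈ , refl
  from : ∀ {x} → OptionMax G x → OptionMax (0 ∷ G) x
  from (t , t∈ , refl) = 0 ∷ t , ∈-allMoves⁺ 0 G (here refl) t∈ , refl

OptionMax-empty : ∀ G → allEmpty G ≡ true → OptionMax G ≐ (_≡ 0)
OptionMax-empty []       _  = (λ { (_ , here refl , x≡0) → x≡0 }) , λ { refl → [] , here refl , refl }
OptionMax-empty (zero ∷ G) e = ≐-trans (OptionMax-0∷ G) (OptionMax-empty G e)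

componentMax-empty : ∀ G → allEmpty G ≡ true → componentMax G ≡ 0
componentMax-empty []         _ = refl
componentMax-empty (zero ∷ G) e = componentMax-empty G e

OptionMax-∈ : ∀ G → OptionMax G ≐ (_∈ map componentMax (allMoves G))
OptionMax-∈ G = (λ { (O , O∈ , refl) → ∈-map⁺ componentMax O∈ }) , ∈-map⁻ componentMax

SpByRule : ℕ → Set
SpByRule k = ∃ λ m → Chosen (MoveMax (suc k)) m × Sp (suc k) ≡ suc m

componentMax-chosen : ∀ n → (∀ k → suc k ≤ n → SpByRule k) →
  ∀ G → allEmpty G ≡ false → sum G ≤ n → ∃ λ m → Chosen (OptionMax G) m × componentMax G ≡ suc m
componentMax-chosen n chosen (zero ∷ G) ne G≤n with componentMax-chosen n chosen G ne G≤n
... | m , c , eq = m , Chosen-resp (≐-sym (OptionMax-0∷ G)) c , eq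
componentMax-chosen n chosen (suc k ∷ G) ne G≤n with chosen k (m+n≤o⇒m≤o (suc k) G≤n) | allEmpty G in eG
... | m , c , eq | true =
  m ⊔ 0 , Chosen-resp (≐-sym (OptionMax-∷ (suc k) G)) (Chosen-⊔ᵖ c chosen-0) ,
  trans (cong₂ _⊔_ eq (componentMax-empty G eG)) (cong suc (sym (⊔-identityʳ m)))
  where
  chosen-0 : Chosen (OptionMax G) 0
  chosen-0 = Chosen-resp (≐-sym (OptionMax-empty G eG)) (Chosen-const refl (λ y≡0 → y≡0))
... | m , c , eq | false with componentMax-chosen n chosen G eG (m+n≤o⇒n≤o (suc k) G≤n)
...   | m′ , c′ , eq′ = m ⊔ m′ , Chosen-resp (≐-sym (OptionMax-∷ (suc k) G)) (Chosen-⊔ᵖ c c′) , cong₂ _⊔_ eq eq′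

SuspenseIsComponentMaxBelow : ℕ → Set
SuspenseIsComponentMaxBelow n = ∀ G f → sum G < n → sum G < f → suspenseF f G ≡ componentMax G

options-nonempty : ∀ G → allEmpty G ≡ false → options G ≡ allMoves G
options-nonempty G e = cong (if_then [] else allMoves G) e

options-empty : ∀ G → allEmpty G ≡ true → options G ≡ []
options-empty G e = cong (if_then [] else allMoves G) e

suspenseF-chosen : ∀ {n G f m} → SuspenseIsComponentMaxBelow n → allEmpty G ≡ false →
  sum G ≤ n → sum G ≤ f → Chosen (OptionMax G) m → suspenseF (suc f) G ≡ suc m
suspenseF-chosen {n} {G} {f} {m} agrees ne G≤n G≤f c = begin
  suspenseF (suc f) G                                ≡⟨ suspenseF-unfold f G ⟩
  suspenseRule (map (suspenseF f) (options G))       ≡⟨ cong (suspenseRule ∘ map (suspenseF f)) (options-nonempty G ne) ⟩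
  suspenseRule (map (suspenseF f) (allMoves G))      ≡⟨ cong suspenseRule (map-cong-local (All.tabulate options-agree)) ⟩
  suspenseRule (map componentMax (allMoves G))       ≡⟨ suspenseRule-chosen (Chosen-resp (OptionMax-∈ G) c) ⟩
  suc m                                              ∎
  where
  open ≡-Reasoning
  options-agree : ∀ {O} → O ∈ allMoves G → suspenseF f O ≡ componentMax O
  options-agree O∈ = agrees _ f (<-≤-trans (allMoves-shrink G ne O∈) G≤n) (<-≤-trans (allMoves-shrink G ne O∈) G≤f)

OptionMax-single : ∀ k → OptionMax (k ∷ []) ≐ MoveMax k
OptionMax-single k = to , from
  where
  to : ∀ {x} → OptionMax (k ∷ []) x → MoveMax k x
  to (O , O∈ , refl) with ∈-allMoves⁻ k [] O∈
  ... | r , _ , r∈ , here refl , refl = r , r∈ , cong componentMax (++-identityʳ r)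
  from : ∀ {x} → MoveMax k x → OptionMax (k ∷ []) x
  from (r , r∈ , refl) = r ++ [] , ∈-allMoves⁺ k [] r∈ (here refl) , cong componentMax (sym (++-identityʳ r))

MoveMax-∈ : ∀ k → MoveMax k ≐ (_∈ map componentMax (moves k))
MoveMax-∈ k = (λ { (r , r∈ , refl) → ∈-map⁺ componentMax r∈ }) , ∈-map⁻ componentMax

moves-nonempty : ∀ k → ∃ (_∈ moves k)
moves-nonempty 0 = _ , here refl
moves-nonempty 1 = _ , here refl
moves-nonempty 2 = _ , here refl
moves-nonempty 3 = _ , here refl
moves-nonempty (suc (suc (suc (suc _)))) = _ , here refl

Sp-chosen-below : ∀ {k m} → SuspenseIsComponentMaxBelow (suc k) → Chosen (MoveMax (suc k)) m → Sp (suc k) ≡ suc m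
Sp-chosen-below {k} agrees c =
  suspenseF-chosen {G = suc k ∷ []} {f = suc k + 0} agrees refl (≤-reflexive (+-identityʳ (suc k))) ≤-refl
    (Chosen-resp (≐-sym (OptionMax-single (suc k))) c)

SpByRule-below : ∀ k → SuspenseIsComponentMaxBelow (suc k) → SpByRule k
SpByRule-below k agrees with chosen-exists _ (∈-map⁺ componentMax (proj₂ (moves-nonempty (suc k))))
... | m , c = m , c′ , Sp-chosen-below agrees c′
  where
  c′ : Chosen (MoveMax (suc k)) m
  c′ = Chosen-resp (≐-sym (MoveMax-∈ (suc k))) c

suspenseF-componentMax : ∀ n → SuspenseIsComponentMaxBelow n
suspenseF-componentMax (suc n) G (suc f) G<1+n G<1+f = by-emptiness (allEmpty G) refl
  where
  open ≡-Reasoning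
  agrees-below : ∀ k → k ≤ n → SuspenseIsComponentMaxBelow k
  agrees-below k k≤n G f G<k = suspenseF-componentMax n G f (<-≤-trans G<k k≤n)
  by-emptiness : ∀ b → allEmpty G ≡ b → suspenseF (suc f) G ≡ componentMax G
  by-emptiness true e = begin
    suspenseF (suc f) G                           ≡⟨ suspenseF-unfold f G ⟩
    suspenseRule (map (suspenseF f) (options G))  ≡⟨ cong (suspenseRule ∘ map (suspenseF f)) (options-empty G e) ⟩
    0                                             ≡⟨ componentMax-empty G e ⟨
    componentMax G                                ∎
  by-emptiness false e
    with componentMax-chosen n (λ k k<n → SpByRule-below k (agrees-below (suc k) k<n)) G e (≤-pred G<1+n)
  ... | m , c , eq = trans (suspenseF-chosen {G = G} (suspenseF-componentMax n) e (≤-pred G<1+n) (≤-pred G<1+f) c) (sym eq)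

Sp-chosen : ∀ k {m} → Chosen (MoveMax (suc k)) m → Sp (suc k) ≡ suc m
Sp-chosen k = Sp-chosen-below (suspenseF-componentMax (suc k))

end-option : ∀ m → MoveMax (4 + m) (Sp (2 + m))
end-option m = _ , here refl , sym (⊔-identityʳ _)

next-to-end-option : ∀ m → MoveMax (4 + m) (Sp (1 + m))
next-to-end-option m = _ , there (here refl) , sym (⊔-identityʳ _)

split-option : ∀ {m i j} → 1 ≤ i → i ≤ j → i + j ≡ 1 + m → MoveMax (4 + m) (Sp i ⊔ Sp j)
split-option {j = j} 1≤i i≤j i+j≡1+m =
  _ , there (there (∈-splits⁺ 1≤i i≤j i+j≡1+m)) , cong (_ ⊔_) (sym (⊔-identityʳ (Sp j)))

SpMonotoneUpTo : ℕ → Set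
SpMonotoneUpTo b = ∀ {x y} → x ≤ y → y ≤ b → Sp x ≤ Sp y

MoveMax-largest : ∀ {m y} → SpMonotoneUpTo (2 + m) → MoveMax (4 + m) y →
  ∃ λ x → 1 + m ≤ x + x × x ≤ 2 + m × y ≡ Sp x
MoveMax-largest {m} _ (_ , here refl , refl) =
  2 + m , ≤-trans (n≤1+n (1 + m)) (m≤m+n (2 + m) (2 + m)) , ≤-refl , ⊔-identityʳ _
MoveMax-largest {m} _ (_ , there (here refl) , refl) =
  1 + m , m≤m+n (1 + m) (1 + m) , n≤1+n (1 + m) , ⊔-identityʳ _
MoveMax-largest {m} mono (_ , there (there r∈) , refl) with ∈-splits⁻ r∈
... | i , j , _ , i≤j , i+j≡1+m , refl =
  j , subst (_≤ j + j) i+j≡1+m (+-monoˡ-≤ j i≤j) , j≤2+m ,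
  trans (cong (Sp i ⊔_) (⊔-identityʳ (Sp j))) (m≤n⇒m⊔n≡n (mono i≤j j≤2+m))
  where
  j≤2+m : j ≤ 2 + m
  j≤2+m = ≤-trans (subst (j ≤_) i+j≡1+m (m≤n+m j i)) (n≤1+n (1 + m))

≼-2*n+1 : ∀ {y} n → y ≤ 2 * n + 2 → y ≼ 2 * n + 1
≼-2*n+1 {y} n y≤2n+2 with parity y
... | inj₂ ey = even≼odd ey (odd-2*n+1 n)
... | inj₁ oy with m≤n⇒m<n∨m≡n y≤2n+2
...   | inj₁ y<2n+2 = odd≼odd oy (odd-2*n+1 n) (≤-pred (subst (y <_) (+-suc (2 * n) 1) y<2n+2))
...   | inj₂ refl  = ⊥-elim (odd⇒¬even oy (even-2*n+2 n))

half-lower : ∀ {c x} → c + c < x + x → c < x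
half-lower {c} {x} c+c<x+x with c <? x
... | yes c<x = c<x
... | no c≮x = ⊥-elim (<⇒≱ c+c<x+x (+-mono-≤ (≮⇒≥ c≮x) (≮⇒≥ c≮x)))

2^n≡1+p : ∀ n → ∃ λ p → 2 ^ n ≡ suc p
2^n≡1+p n with 2 ^ n | m^n>0 2 n
... | suc p | _ = p , refl

2^[1+n]≡1+p : ∀ n {p} → 2 ^ suc n ≡ suc p → ∃ λ q → 2 ^ n ≡ suc q × p ≡ 2 * q + 1
2^[1+n]≡1+p n e with 2^n≡1+p n
... | q , e′ = q , e′ , suc-injective (trans (sym e) (trans (cong (2 *_) e′) (2*[1+n] q)))

-- p = 2ⁿ − 1 is carried as a witness of 2 ^ n ≡ suc p so that no truncated subtraction occurs;
-- level n consists of the odd block [7p+1, 7p+2] followed by the even block [7p+3, 14p+7].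
BlockValues : ℕ → Set
BlockValues k = ∀ n p → 2 ^ n ≡ suc p →
  (7 * p + 1 ≤ k → k ≤ 7 * p + 2 → Sp k ≡ 2 * n + 1) ×
  (7 * p + 3 ≤ k → k ≤ 14 * p + 7 → Sp k ≡ 2 * n + 2)

BlockValuesBelow : ℕ → Set
BlockValuesBelow k = ∀ {j} → j < k → BlockValues j

levels-cover : ∀ k → 1 ≤ k → ∃₂ λ n p → 2 ^ n ≡ suc p × 7 * p + 1 ≤ k × k ≤ 14 * p + 7
levels-cover 1 _ = 0 , 0 , refl , ≤-refl , s≤s z≤n
levels-cover (suc (suc k)) _ with levels-cover (suc k) (s≤s z≤n)
... | n , p , e , lo , hi with suc (suc k) ≤? 14 * p + 7
...   | yes hi′ = n , p , e , ≤-trans lo (n≤1+n _) , hi′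
...   | no  hi′ = suc n , 2 * p + 1 , trans (cong (2 *_) e) (2*[1+n] p) , ≤-reflexive next-start , next-end
  where
  1+k≡ : suc k ≡ 14 * p + 7
  1+k≡ = ≤-antisym hi (≤-pred (≰⇒> hi′))
  level-start : ∀ p → 7 * (2 * p + 1) + 1 ≡ suc (14 * p + 7)
  level-start = solve-∀
  next-start : 7 * (2 * p + 1) + 1 ≡ suc (suc k)
  next-start = trans (level-start p) (cong suc (sym 1+k≡))
  level-size : ∀ x → 14 * x + 7 ≡ (7 * x + 1) + (7 * x + 6)
  level-size = solve-∀
  next-end : suc (suc k) ≤ 14 * (2 * p + 1) + 7
  next-end = ≤-trans (≤-reflexive (sym next-start)) (≤-trans (m≤m+n _ _) (≤-reflexive (sym (level-size (2 * p + 1)))))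

7p+3≤ : ∀ p {x} → 7 * p + 2 < x → 7 * p + 3 ≤ x
7p+3≤ p {x} = subst (_≤ x) (sym (+-suc (7 * p) 2))

Sp-level-bounds : ∀ {x} n {p} → BlockValues x → 2 ^ n ≡ suc p →
  7 * p + 1 ≤ x → x ≤ 14 * p + 7 → 2 * n + 1 ≤ Sp x × Sp x ≤ 2 * n + 2
Sp-level-bounds {x} n {p} values e lo hi with x ≤? 7 * p + 2
... | yes x≤ = subst (λ v → 2 * n + 1 ≤ v × v ≤ 2 * n + 2) (sym (proj₁ (values n p e) lo x≤))
                 (≤-refl , +-monoʳ-≤ (2 * n) (n≤1+n 1))
... | no x≰ = subst (λ v → 2 * n + 1 ≤ v × v ≤ 2 * n + 2) (sym (proj₂ (values n p e) (7p+3≤ p (≰⇒> x≰)) hi))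
                 (+-monoʳ-≤ (2 * n) (n≤1+n 1) , ≤-refl)

Sp-≤-across-levels : ∀ n {p} → BlockValues (7 * p) → BlockValues (suc (7 * p)) → 2 ^ n ≡ suc p →
  Sp (7 * p) ≤ Sp (suc (7 * p))
Sp-≤-across-levels zero _ _ e with suc-injective e
... | refl = z≤n
Sp-≤-across-levels (suc n) values values′ e with 2^[1+n]≡1+p n e
... | q , e′ , refl = begin
  Sp (7 * (2 * q + 1))        ≡⟨ proj₂ (values n q e′) (≤-trans (m≤m+n _ (7 * q + 4)) (≤-reflexive (halves q))) (≤-reflexive (sym (double q))) ⟩
  2 * n + 2                   ≤⟨ n≤1+n _ ⟩
  suc (2 * n + 2)             ≡⟨ 2*[1+n]+1 n ⟨
  2 * suc n + 1               ≡⟨ proj₁ (values′ (suc n) (2 * q + 1) e) (≤-reflexive (+-comm _ 1)) start≤ ⟨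
  Sp (suc (7 * (2 * q + 1)))  ∎
  where
  open ≤-Reasoning
  halves : ∀ q → 7 * q + 3 + (7 * q + 4) ≡ 7 * (2 * q + 1)
  halves = solve-∀
  double : ∀ q → 14 * q + 7 ≡ 7 * (2 * q + 1)
  double = solve-∀
  start≤ : suc (7 * (2 * q + 1)) ≤ 7 * (2 * q + 1) + 2
  start≤ = ≤-trans (≤-reflexive (+-comm 1 _)) (+-monoʳ-≤ _ (n≤1+n 1))

Sp-≤-Sp-suc : ∀ j → BlockValues j → BlockValues (suc j) → Sp j ≤ Sp (suc j)
Sp-≤-Sp-suc j values values′ with levels-cover (suc j) (s≤s z≤n)
... | n , p , e , lo , hi with 7 * p + 1 ≤? j
...   | yes lo′ with j ≤? 7 * p + 2
...     | yes hi′ = ≤-trans (≤-reflexive (proj₁ (values n p e) lo′ hi′)) (proj₁ (Sp-level-bounds n values′ e lo hi))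
...     | no  hi′ = ≤-reflexive (trans (proj₂ (values n p e) (7p+3≤ p (≰⇒> hi′)) (≤-trans (n≤1+n j) hi))
                                       (sym (proj₂ (values′ n p e) (≤-trans (7p+3≤ p (≰⇒> hi′)) (n≤1+n j)) hi)))
Sp-≤-Sp-suc j values values′ | n , p , e , lo , hi | no lo′ =
  subst (λ i → Sp i ≤ Sp (suc i)) (sym j≡7p)
    (Sp-≤-across-levels n (subst BlockValues j≡7p values) (subst (BlockValues ∘ suc) j≡7p values′) e)
  where
  j≡7p : j ≡ 7 * p
  j≡7p = suc-injective (trans (≤-antisym (≰⇒> lo′) lo) (+-comm (7 * p) 1))

Sp-monotone-below : ∀ {k} → BlockValuesBelow k → ∀ {a b} → a ≤ b → b < k → Sp a ≤ Sp b
Sp-monotone-below values a≤b b<k with m≤n⇒m<n∨m≡n a≤b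
... | inj₂ refl = ≤-refl
Sp-monotone-below {k} values {b = suc b} _ 1+b<k | inj₁ (s≤s a≤b) =
  ≤-trans (Sp-monotone-below values a≤b b<k) (Sp-≤-Sp-suc b (values b<k) (values 1+b<k))
  where
  b<k : b < k
  b<k = <-trans (n<1+n b) 1+b<k

SpMonotone-below-4+ : ∀ {m} → BlockValuesBelow (4 + m) → SpMonotoneUpTo (2 + m)
SpMonotone-below-4+ values x≤y y≤2+m = Sp-monotone-below values x≤y (s≤s (≤-trans y≤2+m (n≤1+n _)))

2+m-in-level : ∀ {m} p → 7 * p + 3 ≤ 4 + m → 7 * p + 1 ≤ 2 + m
2+m-in-level {m} p lo = +-cancelˡ-≤ 2 (7 * p + 1) (2 + m) (subst (_≤ 4 + m) (shift p) lo)
  where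
  shift : ∀ p → 7 * p + 3 ≡ 2 + (7 * p + 1)
  shift = solve-∀

<4+ : ∀ {m x} → x ≤ 2 + m → x < 4 + m
<4+ x≤2+m = s≤s (≤-trans x≤2+m (n≤1+n _))

odd-block-option : ∀ {m} p → SpMonotoneUpTo (2 + m) → 7 * p + 3 ≤ 4 + m → 4 + m ≤ 14 * p + 7 →
  ∃ λ x → (7 * p + 1 ≤ x × x ≤ 7 * p + 2) × x ≤ 2 + m × MoveMax (4 + m) (Sp x)
odd-block-option {m} p mono lo hi with m ≤? 7 * p
... | yes m≤7p = 2 + m , (2+m-in-level p lo , 2+m≤7p+2) , ≤-refl , end-option m
  where
  2+m≤7p+2 : 2 + m ≤ 7 * p + 2
  2+m≤7p+2 = ≤-trans (+-monoʳ-≤ 2 m≤7p) (≤-reflexive (+-comm 2 (7 * p)))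
... | no m≰7p with m ≟ 7 * p + 1
...   | yes refl = 1 + m , (n≤1+n _ , ≤-reflexive (sym (+-suc (7 * p) 1))) , n≤1+n _ , next-to-end-option m
...   | no m≢7p+1 = j , (+-monoʳ-≤ (7 * p) (n≤1+n 1) , ≤-refl) , j≤2+m ,
                    subst (MoveMax (4 + m)) (m≤n⇒m⊔n≡n (mono i≤j j≤2+m)) (split-option 1≤i i≤j i+j≡1+m)
  where
  7p+1<m : 7 * p + 1 < m
  7p+1<m = ≤∧≢⇒< (subst (_≤ m) (+-comm 1 (7 * p)) (≰⇒> m≰7p)) (m≢7p+1 ∘ sym)
  7p+1≤m : 7 * p + 1 ≤ m
  7p+1≤m = <⇒≤ 7p+1<m
  i j : ℕ
  i = m ∸ (7 * p + 1)
  j = 7 * p + 2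
  1≤i : 1 ≤ i
  1≤i = m<n⇒0<n∸m 7p+1<m
  j≡1+[7p+1] : j ≡ 1 + (7 * p + 1)
  j≡1+[7p+1] = +-suc (7 * p) 1
  i+j≡1+m : i + j ≡ 1 + m
  i+j≡1+m = trans (cong (i +_) j≡1+[7p+1]) (trans (+-suc i _) (cong suc (m∸n+n≡m 7p+1≤m)))
  level-size : ∀ p → 14 * p + 7 ≡ 4 + (7 * p + 2 + (7 * p + 1))
  level-size = solve-∀
  i≤j : i ≤ j
  i≤j = +-cancelʳ-≤ (7 * p + 1) i j
          (≤-trans (≤-reflexive (m∸n+n≡m 7p+1≤m)) (+-cancelˡ-≤ 4 m _ (≤-trans hi (≤-reflexive (level-size p)))))
  j≤2+m : j ≤ 2 + m
  j≤2+m = ≤-trans (≤-reflexive j≡1+[7p+1]) (≤-trans 7p+1<m (≤-trans (n≤1+n m) (n≤1+n _)))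

Sp-even-block : ∀ {m} n {p} → BlockValuesBelow (4 + m) → 2 ^ n ≡ suc p →
  7 * p + 3 ≤ 4 + m → 4 + m ≤ 14 * p + 7 → Sp (4 + m) ≡ 2 * n + 2
Sp-even-block {m} n {p} values e lo hi with odd-block-option p (SpMonotone-below-4+ values) lo hi
... | x , (x-lo , x-hi) , x≤2+m , option = trans (Sp-chosen (3 + m) (option-2n+1 , bound)) (sym (+-suc (2 * n) 1))
  where
  option-2n+1 : MoveMax (4 + m) (2 * n + 1)
  option-2n+1 = subst (MoveMax (4 + m)) (proj₁ (values (<4+ x≤2+m) n p e) x-lo x-hi) option
  mono : SpMonotoneUpTo (2 + m)
  mono = SpMonotone-below-4+ values
  Sp[2+m]≤ : Sp (2 + m) ≤ 2 * n + 2
  Sp[2+m]≤ = proj₂ (Sp-level-bounds n (values (<4+ ≤-refl)) e (2+m-in-level p lo)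
                                     (≤-trans (n≤1+n _) (≤-trans (n≤1+n _) hi)))
  bound : ∀ {y} → MoveMax (4 + m) y → y ≼ 2 * n + 1
  bound y∈ with MoveMax-largest mono y∈
  ... | x , _ , x≤2+m , refl = ≼-2*n+1 n (≤-trans (mono x≤2+m ≤-refl) Sp[2+m]≤)

Sp-odd-block : ∀ {m} n {p} → BlockValuesBelow (4 + m) → 2 ^ n ≡ suc p →
  7 * p + 1 ≤ 4 + m → 4 + m ≤ 7 * p + 2 → Sp (4 + m) ≡ 2 * n + 1
Sp-odd-block zero _ e _ hi with suc-injective e
... | refl with hi
...   | s≤s (s≤s ())
Sp-odd-block {m} (suc n) values e lo hi with 2^[1+n]≡1+p n e
... | q , e′ , refl =
  trans (Sp-chosen (3 + m) (Chosen-const option-2n+2 every-option-2n+2)) (sym (2*[1+n]+1 n))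
  where
  start : ∀ q → 7 * (2 * q + 1) + 1 ≡ 3 + (14 * q + 5)
  start = solve-∀
  end : ∀ q → 7 * (2 * q + 1) + 2 ≡ 2 + (14 * q + 7)
  end = solve-∀
  halves : ∀ q → suc ((7 * q + 2) + (7 * q + 2)) ≡ 14 * q + 5
  halves = solve-∀
  1+m-lo : 14 * q + 5 ≤ 1 + m
  1+m-lo = +-cancelˡ-≤ 3 _ _ (subst (_≤ 4 + m) (start q) lo)
  2+m-hi : 2 + m ≤ 14 * q + 7
  2+m-hi = +-cancelˡ-≤ 2 _ _ (subst (4 + m ≤_) (end q) hi)
  every-option-2n+2 : ∀ {y} → MoveMax (4 + m) y → y ≡ 2 * n + 2
  every-option-2n+2 y∈ with MoveMax-largest (SpMonotone-below-4+ values) y∈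
  ... | x , 1+m≤x+x , x≤2+m , refl = proj₂ (values (<4+ x≤2+m) n q e′) x-lo (≤-trans x≤2+m 2+m-hi)
    where
    x-lo : 7 * q + 3 ≤ x
    x-lo = 7p+3≤ q (half-lower (≤-trans (≤-reflexive (halves q)) (≤-trans 1+m-lo 1+m≤x+x)))
  option-2n+2 : MoveMax (4 + m) (2 * n + 2)
  option-2n+2 = subst (MoveMax (4 + m)) (every-option-2n+2 (end-option m)) (end-option m)

level-0 : ∀ {k} n {p} → k ≤ 3 → 7 * p + 1 ≤ k → 2 ^ n ≡ suc p → n ≡ 0 × p ≡ 0
level-0 n {zero} _ _ e = [ id , (λ ()) ]′ (m^n≡1⇒n≡0∨m≡1 2 n e) , refl
level-0 _ {suc p} k≤3 lo _ with ≤-trans (≤-reflexive (7*[1+p]+1 p)) (≤-trans lo k≤3)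
  where
  7*[1+p]+1 : ∀ p → 4 + (4 + 7 * p) ≡ 7 * suc p + 1
  7*[1+p]+1 = solve-∀
... | s≤s (s≤s (s≤s ()))

Sp-odd-level-0 : ∀ {k} → 1 ≤ k → k ≤ 2 → Sp k ≡ 1
Sp-odd-level-0 {1} _ _ = refl
Sp-odd-level-0 {2} _ _ = refl
Sp-odd-level-0 {suc (suc (suc _))} _ (s≤s (s≤s ()))

Sp-even-level-0 : ∀ {k} → 3 ≤ k → k ≤ 3 → Sp k ≡ 2
Sp-even-level-0 {3} _ _ = refl
Sp-even-level-0 {1} (s≤s ()) _
Sp-even-level-0 {2} (s≤s (s≤s ())) _
Sp-even-level-0 {suc (suc (suc (suc _)))} _ (s≤s (s≤s (s≤s ())))

BlockValues-≤3 : ∀ {k} → k ≤ 3 → BlockValues k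
BlockValues-≤3 {k} k≤3 n p e = odd-block n p e , even-block n p e
  where
  odd-block : ∀ n p → 2 ^ n ≡ suc p → 7 * p + 1 ≤ k → k ≤ 7 * p + 2 → Sp k ≡ 2 * n + 1
  odd-block n p e lo hi with level-0 n k≤3 lo e
  ... | refl , refl = Sp-odd-level-0 lo hi
  even-block : ∀ n p → 2 ^ n ≡ suc p → 7 * p + 3 ≤ k → k ≤ 14 * p + 7 → Sp k ≡ 2 * n + 2
  even-block n p e lo _ with level-0 n k≤3 (≤-trans (+-monoʳ-≤ (7 * p) (s≤s z≤n)) lo) e
  ... | refl , refl = Sp-even-level-0 lo k≤3

blockValues : ∀ k → BlockValues k
blockValues = <-rec BlockValues values
  where
  values : ∀ k → BlockValuesBelow k → BlockValues k
  values (suc (suc (suc (suc m)))) below n p e = Sp-odd-block n below e , Sp-even-block n below e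
  values 0 _ = BlockValues-≤3 z≤n
  values 1 _ = BlockValues-≤3 (s≤s z≤n)
  values 2 _ = BlockValues-≤3 (s≤s (s≤s z≤n))
  values 3 _ = BlockValues-≤3 ≤-refl

Sp-monotone : ∀ {a b} → a ≤ b → Sp a ≤ Sp b
Sp-monotone a≤b = Sp-monotone-below (λ {j} _ → blockValues j) a≤b (n<1+n _)

∸-of-+ : ∀ {a} c {d} → a ≡ c + d → a ∸ c ≡ d
∸-of-+ c {d} refl = m+n∸m≡n c d

level-endpoints : ∀ n {p} → 2 ^ n ≡ suc p →
  (7 * 2 ^ n ∸ 6 ≡ 7 * p + 1) × (7 * 2 ^ n ∸ 5 ≡ 7 * p + 2) ×
  (7 * 2 ^ n ∸ 4 ≡ 7 * p + 3) × (7 * 2 ^ suc n ∸ 7 ≡ 14 * p + 7)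
level-endpoints n {p} e =
  ∸-of-+ 6 (trans 7*2^n (odd-start p)) , ∸-of-+ 5 (trans 7*2^n (odd-end p)) ,
  ∸-of-+ 4 (trans 7*2^n (even-start p)) , ∸-of-+ 7 (trans (cong (λ a → 7 * (2 * a)) e) (even-end p))
  where
  7*2^n : 7 * 2 ^ n ≡ 7 * suc p
  7*2^n = cong (7 *_) e
  odd-start : ∀ p → 7 * suc p ≡ 6 + (7 * p + 1)
  odd-start = solve-∀
  odd-end : ∀ p → 7 * suc p ≡ 5 + (7 * p + 2)
  odd-end = solve-∀
  even-start : ∀ p → 7 * suc p ≡ 4 + (7 * p + 3)
  even-start = solve-∀
  even-end : ∀ p → 7 * (2 * suc p) ≡ 7 + (14 * p + 7)
  even-end = solve-∀

Sp-level : ∀ n {p} → 2 ^ n ≡ suc p →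
    (Sp (7 * 2 ^ n ∸ 6) ≡ 2 * n + 1)
  × (Sp (7 * 2 ^ n ∸ 5) ≡ 2 * n + 1)
  × (∀ k → 7 * 2 ^ n ∸ 4 ≤ k → k ≤ 7 * 2 ^ (suc n) ∸ 7 → Sp k ≡ 2 * n + 2)
Sp-level n {p} e =
  let odd-start , odd-end , even-start , even-end = level-endpoints n e in
  subst (λ k → Sp k ≡ 2 * n + 1) (sym odd-start) (proj₁ (blockValues (7 * p + 1) n p e) ≤-refl 7p+1≤7p+2) ,
  subst (λ k → Sp k ≡ 2 * n + 1) (sym odd-end) (proj₁ (blockValues (7 * p + 2) n p e) 7p+1≤7p+2 ≤-refl) ,
  λ k lo hi → proj₂ (blockValues k n p e) (subst (_≤ k) even-start lo) (subst (k ≤_) even-end hi)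
  where
  7p+1≤7p+2 : 7 * p + 1 ≤ 7 * p + 2
  7p+1≤7p+2 = +-monoʳ-≤ (7 * p) (n≤1+n 1)

theorem5 : (∀ m n → m ≤ n → Sp m ≤ Sp n)
    × (∀ n → (Sp (7 * 2 ^ n ∸ 6) ≡ 2 * n + 1)
           × (Sp (7 * 2 ^ n ∸ 5) ≡ 2 * n + 1)
           × (∀ k → 7 * 2 ^ n ∸ 4 ≤ k → k ≤ 7 * 2 ^ (suc n) ∸ 7 → Sp k ≡ 2 * n + 2))
theorem5 = (λ m n → Sp-monotone {m} {n}) , λ n → Sp-level n (proj₂ (2^n≡1+p n))
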